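{- In the setting of the context (based schemes $T$ on $X$, $U$ on $Y$, $S$ on $Z$; closed $\tilde T\subseteq S$ whose subscheme on $z_*\tilde T$ is based-isomorphic to $T$ via $\gamma$; based morphism $i:U\to S$ with $i\pi:U\to S/\!\!/\tilde T$ an isomorphism; $|t(ui)|=1$ for all $u\in U$, $t\in\tilde T$), the data $\zeta_y=(T_y,\alpha^y)$ ($y\in Y$) and $\zeta_{y_1}^{y_2}=(T'_{y_1y_2},T''_{y_1y_2},\tilde\zeta_{y_1}^{y_2})$ ($y_1,y_2\in Y$) constructed in the context determine morphisms $\zeta_{y_1}^{y_2}\in\mathrm{Hom}_{\mathcal C}(T_{y_1},T_{y_2})$ and form an action $\zeta$ of $U$ on $T$.
   Context: All schemes are association schemes on finite sets. For a scheme $S$ on $X$, $x\in X$, $s\in S$: $xs=\{y:(x,y)\in s\}$, and for $P\subseteq S$, $xP=\bigcup_{s\in P}xs$. For $p,q\in S$, $pq=\{r\in S:a_{pqr}>0\}$, extended to subsets by unions. $T\subseteq S$ is closed if $T^*T\subseteq T$, normal if $pT=Tp$ for all $p\in S$. For closed $T$: $X/T=\{xT\}$, $s^T=\{(x_1T,x_2T):(x_1',x_2')\in s$ for some $x_1'\in x_1T,x_2'\in x_2T\}$, $S/\!\!/T=\{s^T\}$ a scheme on $X/T$, $\pi:S\to S/\!\!/T$ natural. The subscheme defined by $xT$ is $\{t\cap(xT\times xT):t\in T\}$. A morphism of schemes from $S$ on $X$ to $S'$ on $X'$ is a map $X\to X'$ sending pairs in a common element of $S$ to pairs in a common element of $S'$;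 it induces a map $S\to S'$; isomorphism if both are bijective. Images are written on the right ($x\phi$, $u i$). Based schemes have a basepoint; quotients are based at the coset of the basepoint; based morphisms preserve basepoints. Category $\mathcal C$: for based schemes $T$ on $X$, $U$ on $Y$, $\phi\in\mathrm{Hom}_{\mathcal C}(T,U)$ is a triple: normal closed $T_\phi\subseteq T$, normal closed $U_\phi\subseteq U$, based isomorphism $\tilde\phi:T/\!\!/T_\phi\to U/\!\!/U_\phi$. Composition of $\phi\in\mathrm{Hom}_{\mathcal C}(T,U)$, $\psi\in\mathrm{Hom}_{\mathcal C}(U,V)$ ($V$ on $W$): $T_{\phi\psi}=\{t:\exists u,\ t^{T_\phi}\tilde\phi=u^{U_\phi},\ u^{U_\psi}\tilde\psi=1_W^{V_\psi}\}$, $V_{\phi\psi}=\{v:\exists u,\ 1_X^{T_\phi}\tilde\phi=u^{U_\phi},\ u^{U_\psi}\tilde\psi=v^{V_\psi}\}$, $(xT_{\phi\psi})\widetilde{\phi\psi}=wV_{\phi\psi}$ where $(xT_\phi)\tilde\phi=yU_\phi$ and $(yU_\psi)\tilde\psi=wV_\psi$. $\mathrm{id}_T=(\{1_X\},\{1_X\},\mathrm{id})$. $\phi\le\psi$ means $T_\phi\subseteq T_\psi$, $U_\phi\subseteq U_\psi$, $(xT_\phi)\tilde\phi\subseteq(xT_\psi)\tilde\psi$ for all $x$. $\phi^*\in\mathrm{Hom}_{\mathcal C}(U,T)$ has the same two subsets and isomorphism $\tilde\phi^{ -1}$. For a scheme $T$ on $X$, $\tau=\tau_T$ is the set $T$ with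 its involution, distinguished element $1=1_X$ and constants $a_{pqr}$. A $\tau$-scheme is a pair $(T',\alpha)$, $T'$ a scheme on a based set, $\alpha:\tau\to T'$ a bijection with $1\alpha$ the diagonal, $(p^*)\alpha=(p\alpha)^*$, $a_{(p\alpha)(q\alpha)(r\alpha)}=a_{pqr}$. For $\tau$-schemes $(T_1,\alpha),(T_2,\beta)$ and $\phi\in\mathrm{Hom}_{\mathcal C}(T_1,T_2)$, $\phi(\tau):\mathcal P(\tau)\to\mathcal P(\tau)$ sends $P$ to $\{u\in\tau:(t\alpha)^{(T_1)_\phi}\tilde\phi=(u\beta)^{(T_2)_\phi}$ for some $t\in P\}$. An action $\zeta$ of $U$ (based on $Y$, basepoint $y_*$) on $T$ (based on $X$, basepoint $x_*$): $\tau$-schemes $\zeta_y=(T_y,\alpha^y)$, $T_y$ a scheme on $X$, and $\zeta_{y_1}^{y_2}\in\mathrm{Hom}_{\mathcal C}(T_{y_1},T_{y_2})$, such that (1) $T_{y_*}=T$ and $\alpha^{y_*}=\mathrm{id}$; (2) $\zeta_y^y=\mathrm{id}_{T_y}$; (3) $\zeta_{y_2}^{y_1}=(\zeta_{y_1}^{y_2})^*$; (4) $\zeta_{y_1}^{y_2}(\tau)$ depends only on the $u\in U$ containing $(y_1,y_2)$; (5) $\zeta_{y_1}^{y_3}\le\zeta_{y_1}^{y_2}\zeta_{y_2}^{y_3}$ for all $y_1,y_2,y_3$. Setting: $T$ based on $X$, $U$ based on $Y$, $S$ based on $Z$ (basepoint $z_*$); $\tilde T\subseteq S$ closed with a based isomorphism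 $\gamma$ from $T$ to the subscheme $\tilde T_{y_*}$ defined by $z_*\tilde T$ (based at $z_*$); $i:U\to S$ based morphism with $i\pi:U\to S/\!\!/\tilde T$ an isomorphism; $|t(ui)|=1$ for all $u\in U,t\in\tilde T$. Construction: for $y\in Y$, $\tilde T_y$ is the subscheme of $S$ defined by $(yi)\tilde T$, based at $yi$; $\delta^y:\tilde T_y\to\tilde T$ sends $t\cap((yi)\tilde T)^2$ to $t$. Choose based bijections $\gamma^y_X:X\to(yi)\tilde T$ with $\gamma^{y_*}_X=\gamma_X$; $T_y$ is the scheme on $X$ making $\gamma^y_X$ a based isomorphism $\gamma^y:T_y\to\tilde T_y$; $\alpha^y:\tau\to T_y$ is defined by $(t\alpha^y)\gamma^y\delta^y=t\gamma\delta^{y_*}$. For $u\in U$: $\tilde T'_u=\{t\in\tilde T:t(ui)=\{ui\}\}$, $\tilde T''_u=\{t\in\tilde T:(ui)t=\{ui\}\}$, $\tau'_u=\{t\in\tau:t\gamma\delta^{y_*}\in\tilde T'_u\}$, $\tau''_u=\{t\in\tau:t\gamma\delta^{y_*}\in\tilde T''_u\}$. For $(y_1,y_2)\in u$: $T'_{y_1y_2}=\tau'_u\alpha^{y_1}$, $T''_{y_1y_2}=\tau''_u\alpha^{y_2}$, and $\tilde\zeta_{y_1}^{y_2}:X/T'_{y_1y_2}\to X/T''_{y_1y_2}$ sends $xT'_{y_1y_2}$ to $(z_2(\gamma^{y_2}_X)^{ -1})T''_{y_1y_2}$ for any $z_2\in(x\gamma^{y_1}_X)(ui)\cap(y_2i)\tilde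 T$. -}

module Defs where

open import Data.Nat using (ℕ; zero; suc; _+_)
open import Data.Fin using (Fin; zero; suc; _≟_)
open import Data.Bool using (Bool; true; false; _∧_; if_then_else_)
open import Data.Product using (Σ; ∃; _×_; _,_; ∃-syntax)
open import Relation.Nullary.Decidable using (⌊_⌋)
open import Relation.Binary.PropositionalEquality using (_≡_)

-- A scheme on X = Fin n is given by a labelling
-- S : Fin n → Fin n → Fin m of X × X; the elements (relations) of the
-- scheme are the nonempty fibres, i.e. the labels that occur ('Occ').

infix 2 _⟺_
_⟺_ : Set → Set → Set
A ⟺ B = (A → B) × (B → A)

Rel : ℕ → ℕ → Set
Rel n m = Fin n → Fin n → Fin m

Sub : ℕ → Set₁
Sub m = Fin m → Set

count : ∀ {n} → (Fin n → Bool) → ℕ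
count {zero} f = 0
count {suc n} f = (if f zero then 1 else 0) + count (λ i → f (suc i))

-- |xp ∩ yq*|  (= a_{pqr} when (x,y) ∈ r)
cnt : ∀ {n m} → Rel n m → Fin n → Fin n → Fin m → Fin m → ℕ
cnt S x y p q = count (λ z → ⌊ S x z ≟ p ⌋ ∧ ⌊ S z y ≟ q ⌋)

Occ : ∀ {n m} → Rel n m → Fin m → Set
Occ S s = ∃[ x ] ∃[ y ] (S x y ≡ s)

record IsScheme {n m : ℕ} (S : Rel n m) : Set where
  field
    diagonal : ∃[ e ] (∀ x y → (S x y ≡ e) ⟺ (x ≡ y))
    converse : ∀ x y x' y' → S x y ≡ S x' y' → S y x ≡ S y' x'
    regular  : ∀ x y x' y' → S x y ≡ S x' y' →
               ∀ p q → cnt S x y p q ≡ cnt S x' y' p q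

IsStar : ∀ {n m} → Rel n m → Fin m → Fin m → Set
IsStar S p q = ∃[ x ] ∃[ y ] (S x y ≡ p × S y x ≡ q)

PosA : ∀ {n m} → Rel n m → Fin m → Fin m → Fin m → Set
PosA S p q r = ∃[ x ] ∃[ y ] ∃[ z ] (S x y ≡ r × S x z ≡ p × S z y ≡ q)

SubsetOf : ∀ {n m} → Rel n m → Sub m → Set
SubsetOf S P = ∀ s → P s → Occ S s

Closed : ∀ {n m} → Rel n m → Sub m → Set
Closed S P = ∀ p p' q r → P p → IsStar S p p' → P q → PosA S p' q r → P r

Normal : ∀ {n m} → Rel n m → Sub m → Set
Normal S P = ∀ p r → Occ S p →
  (∃[ t ] (P t × PosA S p t r)) ⟺ (∃[ t ] (P t × PosA S t p r))

-- (x₁P, x₂P) ∈ s^P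
InQ : ∀ {n m} → Rel n m → Sub m → Fin m → Fin n → Fin n → Set
InQ S P s x₁ x₂ = ∃[ a ] ∃[ b ] (P (S x₁ a) × P (S x₂ b) × S a b ≡ s)

-- Raw data of a morphism of 𝒞 : (T_φ, U_φ, φ̃), where
-- 'map x y' means  y ∈ (x T_φ) φ̃  (φ̃ given by its graph on points).

record PreHom (nX mT nY mU : ℕ) : Set₁ where
  field
    dom : Sub mT
    cod : Sub mU
    map : Fin nX → Fin nY → Set
open PreHom public

-- t^{T_φ} φ̃ = u^{U_φ}  (image of the quotient relation under φ̃)
MapsRel : ∀ {nX mT nY mU} → Rel nX mT → Rel nY mU →
          PreHom nX mT nY mU → Fin mT → Fin mU → Set
MapsRel T U φ t u = ∃[ x₁ ] ∃[ x₂ ] ∃[ y₁ ] ∃[ y₂ ]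
  (InQ T (dom φ) t x₁ x₂ × map φ x₁ y₁ × map φ x₂ y₂ × InQ U (cod φ) u y₁ y₂)

record IsHomC {nX mT nY mU : ℕ} (T : Rel nX mT) (x* : Fin nX)
              (U : Rel nY mU) (y* : Fin nY) (φ : PreHom nX mT nY mU) : Set where
  field
    domSub    : SubsetOf T (dom φ)
    domClosed : Closed T (dom φ)
    domNormal : Normal T (dom φ)
    codSub    : SubsetOf U (cod φ)
    codClosed : Closed U (cod φ)
    codNormal : Normal U (cod φ)
    -- φ̃ is a well defined map X/T_φ → Y/U_φ
    total     : ∀ x → ∃[ y ] map φ x y
    coset     : ∀ x y y' → map φ x y → (map φ x y' ⟺ cod φ (U y y'))
    respects  : ∀ x x' → dom φ (T x x') → ∀ y → (map φ x y ⟺ map φ x' y)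
    injective : ∀ x x' y → map φ x y → map φ x' y → dom φ (T x x')
    surjective : ∀ y → ∃[ x ] map φ x y
    based     : map φ x* y*
    -- morphism whose induced map on relations is a bijection
    iso       : ∀ x₁ x₂ x₁' x₂' y₁ y₂ y₁' y₂' →
                map φ x₁ y₁ → map φ x₂ y₂ → map φ x₁' y₁' → map φ x₂' y₂' →
                (∃[ s ] (InQ T (dom φ) s x₁ x₂ × InQ T (dom φ) s x₁' x₂'))
                ⟺ (∃[ u ] (InQ U (cod φ) u y₁ y₂ × InQ U (cod φ) u y₁' y₂'))

idC : ∀ {nX mT} → Rel nX mT → Fin nX → PreHom nX mT nX mT
idC T x* = record { dom = λ t → t ≡ T x* x* ; cod = λ t → t ≡ T x* x* ; map = λ x y → x ≡ y }

starC : ∀ {nX mT nY mU} → PreHom nX mT nY mU → PreHom nY mU nX mT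
starC φ = record { dom = cod φ ; cod = dom φ ; map = λ y x → map φ x y }

compDom : ∀ {nX mT nY mU nW mV} → Rel nX mT → Rel nY mU → Rel nW mV → Fin nW →
          PreHom nX mT nY mU → PreHom nY mU nW mV → Sub mT
compDom T U V w* φ ψ t =
  Occ T t × ∃[ u ] (MapsRel T U φ t u × MapsRel U V ψ u (V w* w*))

compCod : ∀ {nX mT nY mU nW mV} → Rel nX mT → Fin nX → Rel nY mU → Rel nW mV →
          PreHom nX mT nY mU → PreHom nY mU nW mV → Sub mV
compCod T x* U V φ ψ v = ∃[ u ] (MapsRel T U φ (T x* x*) u × MapsRel U V ψ u v)

compC : ∀ {nX mT nY mU nW mV} → Rel nX mT → Fin nX → Rel nY mU → Rel nW mV → Fin nW →
        PreHom nX mT nY mU → PreHom nY mU nW mV → PreHom nX mT nW mV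
compC T x* U V w* φ ψ = record
  { dom = compDom T U V w* φ ψ
  ; cod = compCod T x* U V φ ψ
  ; map = λ x w → ∃[ y ] ∃[ w₀ ] (map φ x y × map ψ y w₀ × compCod T x* U V φ ψ (V w₀ w))
  }

_≈H_ : ∀ {nX mT nY mU} → PreHom nX mT nY mU → PreHom nX mT nY mU → Set
φ ≈H ψ = (∀ t → dom φ t ⟺ dom ψ t) × (∀ u → cod φ u ⟺ cod ψ u)
         × (∀ x y → map φ x y ⟺ map ψ x y)

_≤H_ : ∀ {nX mT nY mU} → PreHom nX mT nY mU → PreHom nX mT nY mU → Set
φ ≤H ψ = (∀ t → dom φ t → dom ψ t) × (∀ u → cod φ u → cod ψ u)
         × (∀ x y → map φ x y → map ψ x y)

-- τ_T-schemes.  τ = τ_T for T on X (base x*); (T', α) with T' a scheme on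
-- X (base x*) and α : τ → T' a bijection given by its graph.

record IsTauScheme {nX mT m' : ℕ} (T : Rel nX mT) (x* : Fin nX)
                   (T' : Rel nX m') (α : Fin mT → Fin m' → Set) : Set where
  field
    scheme : IsScheme T'
    αtotal : ∀ t → Occ T t → ∃[ s ] α t s
    αdom   : ∀ t s → α t s → Occ T t
    αcod   : ∀ t s → α t s → Occ T' s
    αfun   : ∀ t s s' → α t s → α t s' → s ≡ s'
    αinj   : ∀ t t' s → α t s → α t' s → t ≡ t'
    αsurj  : ∀ s → Occ T' s → ∃[ t ] α t s
    αone   : ∀ s → α (T x* x*) s → ∀ x y → (T' x y ≡ s) ⟺ (x ≡ y)
    αstar  : ∀ p q p' q' → IsStar T p q → α p p' → α q q' → IsStar T' p' q'
    αconst : ∀ p q r p' q' r' → α p p' → α q q' → α r r' →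
             ∀ x y x' y' → T x y ≡ r → T' x' y' ≡ r' →
             cnt T x y p q ≡ cnt T' x' y' p' q'

PhiTau : ∀ {nX mT m₁ m₂} → Rel nX mT → Rel nX m₁ → Rel nX m₂ →
         (Fin mT → Fin m₁ → Set) → (Fin mT → Fin m₂ → Set) →
         PreHom nX m₁ nX m₂ → Sub mT → Sub mT
PhiTau T T₁ T₂ α β φ P u = Occ T u × ∃[ t ] ∃[ s ] ∃[ s' ]
  (P t × Occ T t × α t s × β u s' × MapsRel T₁ T₂ φ s s')

record IsAction {nX mT nY mU m' : ℕ} (T : Rel nX mT) (x* : Fin nX)
                (U : Rel nY mU) (y* : Fin nY)
                (Ty : Fin nY → Rel nX m') (α : Fin nY → Fin mT → Fin m' → Set)
                (ζ : Fin nY → Fin nY → PreHom nX m' nX m') : Set₁ where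
  field
    tauScheme : ∀ y → IsTauScheme T x* (Ty y) (α y)
    homC      : ∀ y₁ y₂ → IsHomC (Ty y₁) x* (Ty y₂) x* (ζ y₁ y₂)
    ax1-T     : ∀ x y x' y' → (Ty y* x y ≡ Ty y* x' y') ⟺ (T x y ≡ T x' y')
    ax1-α     : ∀ t s x y → T x y ≡ t → (α y* t s ⟺ Ty y* x y ≡ s)
    ax2       : ∀ y → ζ y y ≈H idC (Ty y) x*
    ax3       : ∀ y₁ y₂ → ζ y₂ y₁ ≈H starC (ζ y₁ y₂)
    ax4       : ∀ y₁ y₂ y₁' y₂' → U y₁ y₂ ≡ U y₁' y₂' → ∀ (P : Sub mT) u →
                PhiTau T (Ty y₁) (Ty y₂) (α y₁) (α y₂) (ζ y₁ y₂) P u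
                ⟺ PhiTau T (Ty y₁') (Ty y₂') (α y₁') (α y₂') (ζ y₁' y₂') P u
    ax5       : ∀ y₁ y₂ y₃ →
                ζ y₁ y₃ ≤H compC (Ty y₁) x* (Ty y₂) (Ty y₃) x* (ζ y₁ y₂) (ζ y₂ y₃)

record Setting {nX mT nY mU nZ mS : ℕ}
               (T : Rel nX mT) (x* : Fin nX) (U : Rel nY mU) (y* : Fin nY)
               (S : Rel nZ mS) (z* : Fin nZ) (Tt : Sub mS)
               (γX : Fin nX → Fin nZ) (iY : Fin nY → Fin nZ) : Set where
  field
    schT : IsScheme T
    schU : IsScheme U
    schS : IsScheme S
    TtSub    : SubsetOf S Tt
    TtClosed : Closed S Tt
    -- γ : T → subscheme of S on z* T̃, a based isomorphism
    γbased : γX x* ≡ z*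
    γinto  : ∀ x → Tt (S z* (γX x))
    γonto  : ∀ z → Tt (S z* z) → ∃[ x ] γX x ≡ z
    γinj   : ∀ x x' → γX x ≡ γX x' → x ≡ x'
    γrel   : ∀ x₁ x₂ x₁' x₂' →
             (T x₁ x₂ ≡ T x₁' x₂') ⟺ (S (γX x₁) (γX x₂) ≡ S (γX x₁') (γX x₂'))
    ibased : iY y* ≡ z*
    imorph : ∀ y₁ y₂ y₁' y₂' → U y₁ y₂ ≡ U y₁' y₂' →
             S (iY y₁) (iY y₂) ≡ S (iY y₁') (iY y₂')
    -- iπ : U → S//T̃ an isomorphism (y ↦ (yi)T̃)
    iπinj  : ∀ y y' → Tt (S (iY y) (iY y')) → y ≡ y'
    iπsurj : ∀ z → ∃[ y ] Tt (S (iY y) z)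
    iπrel  : ∀ y₁ y₂ y₁' y₂' →
             (U y₁ y₂ ≡ U y₁' y₂') ⟺
             (∃[ s ] (InQ S Tt s (iY y₁) (iY y₂) × InQ S Tt s (iY y₁') (iY y₂')))
    -- |t(ui)| = 1 for u ∈ U (ui = S (iY y₁) (iY y₂) for (y₁,y₂) ∈ u), t ∈ T̃
    single : ∀ y₁ y₂ t → Tt t →
             ∃[ r ] (PosA S t (S (iY y₁) (iY y₂)) r ×
                     (∀ r' → PosA S t (S (iY y₁) (iY y₂)) r' → r' ≡ r))

record Choice {nX nY nZ mS : ℕ} (S : Rel nZ mS) (Tt : Sub mS) (x* : Fin nX) (y* : Fin nY)
              (γX : Fin nX → Fin nZ) (iY : Fin nY → Fin nZ)
              (γs : Fin nY → Fin nX → Fin nZ) : Set where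
  field
    cBased : ∀ y → γs y x* ≡ iY y
    cInto  : ∀ y x → Tt (S (iY y) (γs y x))
    cOnto  : ∀ y z → Tt (S (iY y) z) → ∃[ x ] γs y x ≡ z
    cInj   : ∀ y x x' → γs y x ≡ γs y x' → x ≡ x'
    cStar  : ∀ x → γs y* x ≡ γX x

-- T_y : the scheme on X making γ^y_X an isomorphism onto T̃_y
-- (relations labelled by the corresponding element of T̃ ⊆ S)
Ty : ∀ {nX nY nZ mS} → Rel nZ mS → (Fin nY → Fin nX → Fin nZ) → Fin nY → Rel nX mS
Ty S γs y x₁ x₂ = S (γs y x₁) (γs y x₂)

GD : ∀ {nX mT nZ mS} → Rel nX mT → Rel nZ mS → (Fin nX → Fin nZ) → Fin mT → Fin mS → Set
GD T S γX t s = ∃[ x₁ ] ∃[ x₂ ] (T x₁ x₂ ≡ t × S (γX x₁) (γX x₂) ≡ s)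

-- graph of α^y : (t α^y) γ^y δ^y = t γ δ^{y*}
αC : ∀ {nX mT nY nZ mS} → Rel nX mT → Rel nZ mS → (Fin nX → Fin nZ) →
     Fin nY → Fin mT → Fin mS → Set
αC T S γX y t s = Occ T t × GD T S γX t s

TtP : ∀ {nZ mS} → Rel nZ mS → Sub mS → Fin mS → Sub mS
TtP S Tt σ s = Tt s × (∀ r → PosA S s σ r ⟺ r ≡ σ)

TtPP : ∀ {nZ mS} → Rel nZ mS → Sub mS → Fin mS → Sub mS
TtPP S Tt σ s = Tt s × (∀ r → PosA S σ s r ⟺ r ≡ σ)

τP : ∀ {nX mT nZ mS} → Rel nX mT → Rel nZ mS → Sub mS → (Fin nX → Fin nZ) → Fin mS → Sub mT
τP T S Tt γX σ t = Occ T t × ∃[ s ] (GD T S γX t s × TtP S Tt σ s)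

τPP : ∀ {nX mT nZ mS} → Rel nX mT → Rel nZ mS → Sub mS → (Fin nX → Fin nZ) → Fin mS → Sub mT
τPP T S Tt γX σ t = Occ T t × ∃[ s ] (GD T S γX t s × TtPP S Tt σ s)

TP : ∀ {nX mT nY nZ mS} → Rel nX mT → Rel nZ mS → Sub mS → (Fin nX → Fin nZ) →
     (Fin nY → Fin nZ) → Fin nY → Fin nY → Sub mS
TP T S Tt γX iY y₁ y₂ s = ∃[ t ] (τP T S Tt γX (S (iY y₁) (iY y₂)) t × αC T S γX y₁ t s)

TPP : ∀ {nX mT nY nZ mS} → Rel nX mT → Rel nZ mS → Sub mS → (Fin nX → Fin nZ) →
      (Fin nY → Fin nZ) → Fin nY → Fin nY → Sub mS
TPP T S Tt γX iY y₁ y₂ s = ∃[ t ] (τPP T S Tt γX (S (iY y₁) (iY y₂)) t × αC T S γX y₂ t s)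

-- ζ_{y₁}^{y₂} = (T'_{y₁y₂}, T''_{y₁y₂}, ζ̃_{y₁}^{y₂}); 'map x x'' means
-- x' ∈ (z₂ (γ^{y₂}_X)⁻¹) T''_{y₁y₂} for some z₂ ∈ (x γ^{y₁}_X)(ui) ∩ (y₂ i)T̃
ζC : ∀ {nX mT nY nZ mS} → Rel nX mT → Rel nZ mS → Sub mS → (Fin nX → Fin nZ) →
     (Fin nY → Fin nZ) → (Fin nY → Fin nX → Fin nZ) → Fin nY → Fin nY → PreHom nX mS nX mS
ζC T S Tt γX iY γs y₁ y₂ = record
  { dom = TP T S Tt γX iY y₁ y₂
  ; cod = TPP T S Tt γX iY y₁ y₂
  ; map = λ x x' → ∃[ z₂ ] ∃[ x₀ ]
      (S (γs y₁ x) z₂ ≡ S (iY y₁) (iY y₂) × Tt (S (iY y₂) z₂) × γs y₂ x₀ ≡ z₂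
       × TPP T S Tt γX iY y₁ y₂ (Ty S γs y₂ x₀ x'))
  }

-- Everything is computed inside S.  T_y is the coset (yi)T̃ read through γ^y, and ζ̃_{y₁}^{y₂}
-- sends x to the points x' with (xγ^{y₁}, x'γ^{y₂}) ∈ σ := ui, for the u containing (y₁, y₂).
-- Since |tσ| = 1 for t ∈ T̃, an element t ∈ T̃ lies in T̃'_u exactly when the two ends of a
-- t-edge have a common σ-successor, and dually for T̃''_u.  From this, T'_{y₁y₂} and T''_{y₁y₂}
-- are closed and normal and ζ̃ is a relation-preserving bijection of the quotients.  Relations
-- s, s' correspond under ζ̃ iff sσ ∩ σs' ≠ ∅, which depends on u only (axiom 4), and the
-- composition axiom comes from factoring a step in σ_{y₁y₃} through the coset of y₂.

module Submission where

open import Defs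
open import Data.Nat.Properties using (+-0-commutativeMonoid; ≤-trans; m≤n+m; +-identityʳ)
open import Algebra.Properties.CommutativeMonoid.Sum +-0-commutativeMonoid
  using (sum-syntax; ∑-comm; sum-cong-≗; sum-replicate-zero)
open import Data.Bool using (Bool; true; false; _∧_; if_then_else_)
open import Data.Fin using (Fin; zero; suc; _≟_)
open import Data.Fin.Properties using (suc-injective; any?)
open import Data.Nat using (ℕ; zero; suc; _+_; _<_; z≤n; s≤s)
open import Data.Product using (_×_; _,_; ∃-syntax; proj₁; proj₂; swap)
open import Function using (_∘_)
open import Relation.Nullary using (¬_; Dec; yes; no; contradiction)
open import Relation.Nullary.Decidable using (⌊_⌋)
open import Relation.Binary.PropositionalEquality

⌊⌋-true : ∀ {A : Set} (a? : Dec A) → A → ⌊ a? ⌋ ≡ true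
⌊⌋-true (yes _) _ = refl
⌊⌋-true (no ¬a) a = contradiction a ¬a

⌊⌋-false : ∀ {A : Set} (a? : Dec A) → ¬ A → ⌊ a? ⌋ ≡ false
⌊⌋-false (yes a) ¬a = contradiction a ¬a
⌊⌋-false (no _) _ = refl

⌊⌋-sound : ∀ {A : Set} (a? : Dec A) → ⌊ a? ⌋ ≡ true → A
⌊⌋-sound (yes a) _ = a

⌊⌋-cong : ∀ {A B : Set} (a? : Dec A) (b? : Dec B) → (A ⟺ B) → ⌊ a? ⌋ ≡ ⌊ b? ⌋
⌊⌋-cong (yes a) b? (f , _) = sym (⌊⌋-true b? (f a))
⌊⌋-cong (no ¬a) b? (_ , g) = sym (⌊⌋-false b? (¬a ∘ g))

∧-true : ∀ {a b} → a ∧ b ≡ true → a ≡ true × b ≡ true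
∧-true {true} {true} _ = refl , refl

indicator : Bool → ℕ
indicator b = if b then 1 else 0

count≡∑ : ∀ {n} (f : Fin n → Bool) → count f ≡ ∑[ i < n ] indicator (f i)
count≡∑ {zero} f = refl
count≡∑ {suc n} f = cong (indicator (f zero) +_) (count≡∑ (f ∘ suc))

count-cong : ∀ {n} {f g : Fin n → Bool} → (∀ i → f i ≡ g i) → count f ≡ count g
count-cong {zero} eq = refl
count-cong {suc n} eq = cong₂ (λ b k → indicator b + k) (eq zero) (count-cong (eq ∘ suc))

count-none : ∀ {n} (f : Fin n → Bool) → (∀ i → f i ≡ false) → count f ≡ 0
count-none {zero} f none = refl
count-none {suc n} f none rewrite none zero = count-none (f ∘ suc) (none ∘ suc)

count-unique : ∀ {n} (f : Fin n → Bool) (i : Fin n) → f i ≡ true →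
               (∀ j → f j ≡ true → j ≡ i) → count f ≡ 1
count-unique f zero fi unique rewrite fi = cong suc (count-none (f ∘ suc) others)
  where
  others : ∀ j → f (suc j) ≡ false
  others j with f (suc j) in fj
  ... | false = refl
  ... | true with () ← unique (suc j) fj
count-unique f (suc i) fi unique with f zero in f0
... | true with () ← unique zero f0
... | false = count-unique (f ∘ suc) i fi (λ j fj → suc-injective (unique (suc j) fj))

count-pos : ∀ {n} (f : Fin n → Bool) (i : Fin n) → f i ≡ true → 0 < count f
count-pos f zero fi rewrite fi = s≤s z≤n
count-pos f (suc i) fi = ≤-trans (count-pos (f ∘ suc) i fi) (m≤n+m _ (indicator (f zero)))

count-witness : ∀ {n} (f : Fin n → Bool) → 0 < count f → ∃[ i ] (f i ≡ true)
count-witness {suc n} f pos with f zero in f0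
... | true = zero , f0
... | false = let i , fi = count-witness (f ∘ suc) pos in suc i , fi

∑-zero : ∀ {n} (f : Fin n → ℕ) → (∀ i → f i ≡ 0) → ∑[ i < n ] f i ≡ 0
∑-zero {n} f f≗0 = trans (sum-cong-≗ {n} {f} {λ _ → 0} f≗0) (sum-replicate-zero n)

∑-indicator-unique : ∀ {n} (a : Fin n) (h : Fin n → ℕ) →
                     ∑[ z < n ] (if ⌊ a ≟ z ⌋ then h z else 0) ≡ h a
∑-indicator-unique {suc n} zero h = begin
  h zero + ∑[ z < n ] (if ⌊ zero ≟ suc z ⌋ then h (suc z) else 0)
    ≡⟨ cong (h zero +_) (∑-zero {n} _ (λ z → refl)) ⟩
  h zero + 0
    ≡⟨ +-identityʳ _ ⟩
  h zero ∎
  where open ≡-Reasoning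
∑-indicator-unique {suc n} (suc a) h =
  trans (sum-cong-≗ shift) (∑-indicator-unique a (h ∘ suc))
  where
  shift : ∀ z → (if ⌊ suc a ≟ suc z ⌋ then h (suc z) else 0) ≡ (if ⌊ a ≟ z ⌋ then h (suc z) else 0)
  shift z rewrite ⌊⌋-cong (suc a ≟ suc z) (a ≟ z) (suc-injective , cong suc) = refl

count-reindex : ∀ {m n} (g : Fin m → Fin n) (f : Fin n → Bool) →
                (∀ x x' → g x ≡ g x' → x ≡ x') → (∀ z → f z ≡ true → ∃[ x ] (g x ≡ z)) →
                count (f ∘ g) ≡ count f
count-reindex {m} {n} g f g-inj f⊆im = begin
  count (f ∘ g)
    ≡⟨ count≡∑ (f ∘ g) ⟩
  ∑[ x < m ] indicator (f (g x))
    ≡⟨ sum-cong-≗ (λ x → sym (∑-indicator-unique (g x) (indicator ∘ f))) ⟩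
  ∑[ x < m ] ∑[ z < n ] δ x z
    ≡⟨ ∑-comm δ ⟩
  ∑[ z < n ] ∑[ x < m ] δ x z
    ≡⟨ sum-cong-≗ fibre ⟩
  ∑[ z < n ] indicator (f z)
    ≡⟨ count≡∑ f ⟨
  count f ∎
  where
  open ≡-Reasoning
  δ : Fin m → Fin n → ℕ
  δ x z = if ⌊ g x ≟ z ⌋ then indicator (f z) else 0
  fibre : ∀ z → ∑[ x < m ] δ x z ≡ indicator (f z)
  fibre z with f z in fz
  ... | false = ∑-zero {m} _ (λ x → if-same ⌊ g x ≟ z ⌋)
    where
    if-same : ∀ b → (if b then 0 else 0) ≡ 0
    if-same true = refl
    if-same false = refl
  ... | true = let x₀ , gx₀ = f⊆im z fz in
    trans (sym (count≡∑ (λ x → ⌊ g x ≟ z ⌋)))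
          (count-unique _ x₀ (⌊⌋-true (g x₀ ≟ z) gx₀)
             (λ x gx → g-inj x x₀ (trans (⌊⌋-sound (g x ≟ z) gx) (sym gx₀))))

module SchemeProperties {n m} {S : Rel n m} (scheme : IsScheme S) where
  open IsScheme scheme

  𝟙 : Fin m
  𝟙 = proj₁ diagonal

  S-diag : ∀ x → S x x ≡ 𝟙
  S-diag x = proj₂ (proj₂ diagonal x x) refl

  S-diag-inj : ∀ {x y} → S x y ≡ 𝟙 → x ≡ y
  S-diag-inj {x} {y} = proj₁ (proj₂ diagonal x y)

  S-diag-≡ : ∀ x y → S x x ≡ S y y
  S-diag-≡ x y = trans (S-diag x) (sym (S-diag y))

  S-converse : ∀ {x y x' y'} → S x y ≡ S x' y' → S y x ≡ S y' x'
  S-converse = converse _ _ _ _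

  -- regularity: whether a_{pqr} > 0 depends only on r
  S-transfer : ∀ {x y x' y' z p q} → S x y ≡ S x' y' → S x z ≡ p → S z y ≡ q →
               ∃[ z' ] (S x' z' ≡ p × S z' y' ≡ q)
  S-transfer {x} {y} {x'} {y'} {z} {p} {q} xy≡x'y' xz zy =
    let z' , path = count-witness (path-at x' y')
                      (subst (0 <_) (regular x y x' y' xy≡x'y' p q)
                        (count-pos (path-at x y) z (cong₂ _∧_ (⌊⌋-true (S x z ≟ p) xz)
                                                              (⌊⌋-true (S z y ≟ q) zy))))
        x'z' , z'y' = ∧-true path
    in z' , ⌊⌋-sound (S x' z' ≟ p) x'z' , ⌊⌋-sound (S z' y' ≟ q) z'y'
    where
    path-at : Fin n → Fin n → Fin n → Bool
    path-at a b w = ⌊ S a w ≟ p ⌋ ∧ ⌊ S w b ≟ q ⌋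

  Occ-from : ∀ {s} → Occ S s → ∀ x → ∃[ y ] (S x y ≡ s)
  Occ-from (a , b , ab) x =
    let y , xy , _ = S-transfer (S-diag-≡ a x) ab refl in y , xy

module ClosedProperties {n m} {S : Rel n m} (scheme : IsScheme S)
                        {P : Sub m} (closed : Closed S P) where
  open SchemeProperties scheme

  closed-diag : ∀ {a b} → P (S a b) → ∀ c → P (S c c)
  closed-diag {a} {b} p c =
    subst P (S-diag-≡ b c) (closed _ _ _ _ p (a , b , refl , refl) p (b , b , a , refl , refl , refl))

  closed-sym : ∀ {a b} → P (S a b) → P (S b a)
  closed-sym {a} {b} p =
    closed _ _ _ _ p (a , b , refl , refl) (closed-diag p b) (b , a , a , refl , refl , S-diag-≡ a b)

  closed-trans : ∀ {a b c} → P (S a b) → P (S b c) → P (S a c)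
  closed-trans {a} {b} {c} p q =
    closed _ _ _ _ (closed-sym p) (b , a , refl , refl) q (a , c , b , refl , refl , refl)

module CosetRestriction {n m k} {S : Rel n m} (scheme : IsScheme S)
                        {P : Sub m} (closed : Closed S P) (z₀ : Fin n) (h : Fin k → Fin n)
                        (h-inj : ∀ x x' → h x ≡ h x' → x ≡ x')
                        (h-into : ∀ x → P (S z₀ (h x)))
                        (h-onto : ∀ z → P (S z₀ z) → ∃[ x ] (h x ≡ z)) where
  open IsScheme scheme
  open SchemeProperties scheme
  open ClosedProperties scheme closed

  Sʰ : Rel k m
  Sʰ a b = S (h a) (h b)

  Sʰ-cnt : ∀ a b p q → P p → cnt Sʰ a b p q ≡ cnt S (h a) (h b) p q
  Sʰ-cnt a b p q Pp = count-reindex h (λ z → ⌊ S (h a) z ≟ p ⌋ ∧ ⌊ S z (h b) ≟ q ⌋) h-inj support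
    where
    support : ∀ z → (⌊ S (h a) z ≟ p ⌋ ∧ ⌊ S z (h b) ≟ q ⌋) ≡ true → ∃[ x ] (h x ≡ z)
    support z path = h-onto z (closed-trans (h-into a)
                       (subst P (sym (⌊⌋-sound (S (h a) z ≟ p) (proj₁ (∧-true path)))) Pp))

  Sʰ-cnt-outside : ∀ a b p q → ¬ (∃[ w ] (Sʰ a w ≡ p)) → cnt Sʰ a b p q ≡ 0
  Sʰ-cnt-outside a b p q ∄w = count-none _ (λ w → cong (_∧ _) (⌊⌋-false (Sʰ a w ≟ p) (λ aw → ∄w (w , aw))))

  Sʰ-regular-in : ∀ {a b a' b'} → Sʰ a b ≡ Sʰ a' b' → ∀ {p} q → P p →
                  cnt Sʰ a b p q ≡ cnt Sʰ a' b' p q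
  Sʰ-regular-in {a} {b} {a'} {b'} ab≡a'b' {p} q Pp = begin
    cnt Sʰ a b p q           ≡⟨ Sʰ-cnt a b p q Pp ⟩
    cnt S (h a) (h b) p q    ≡⟨ regular _ _ _ _ ab≡a'b' p q ⟩
    cnt S (h a') (h b') p q  ≡⟨ Sʰ-cnt a' b' p q Pp ⟨
    cnt Sʰ a' b' p q ∎
    where open ≡-Reasoning

  Sʰ-regular : ∀ a b a' b' → Sʰ a b ≡ Sʰ a' b' → ∀ p q → cnt Sʰ a b p q ≡ cnt Sʰ a' b' p q
  Sʰ-regular a b a' b' ab≡a'b' p q
    with any? (λ w → Sʰ a w ≟ p) | any? (λ w → Sʰ a' w ≟ p)
  ... | yes (w , aw) | _ =
    Sʰ-regular-in ab≡a'b' q (subst P aw (closed-trans (closed-sym (h-into a)) (h-into w)))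
  ... | no _ | yes (w , a'w) =
    Sʰ-regular-in ab≡a'b' q (subst P a'w (closed-trans (closed-sym (h-into a')) (h-into w)))
  ... | no ∄w | no ∄w' = trans (Sʰ-cnt-outside a b p q ∄w) (sym (Sʰ-cnt-outside a' b' p q ∄w'))

  Sʰ-scheme : IsScheme Sʰ
  Sʰ-scheme = record
    { diagonal = 𝟙 , λ x y → (λ xy → h-inj x y (S-diag-inj xy)) , (λ { refl → S-diag (h x) })
    ; converse = λ _ _ _ _ → S-converse
    ; regular  = Sʰ-regular
    }

module Construction {nX mT nY mU nZ mS : ℕ}
  (T : Rel nX mT) (x* : Fin nX) (U : Rel nY mU) (y* : Fin nY)
  (S : Rel nZ mS) (z* : Fin nZ) (Tt : Sub mS)
  (γX : Fin nX → Fin nZ) (iY : Fin nY → Fin nZ)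
  (setting : Setting T x* U y* S z* Tt γX iY)
  (γs : Fin nY → Fin nX → Fin nZ) (choice : Choice S Tt x* y* γX iY γs) where

  open Setting setting
  open Choice choice
  open SchemeProperties schS
  open ClosedProperties schS TtClosed

  Coset : Fin nY → Fin nZ → Set
  Coset y z = Tt (S (iY y) z)

  base∈coset : ∀ y → Coset y (iY y)
  base∈coset y = closed-diag (γinto x*) (iY y)

  coset-step : ∀ {y a b} → Coset y a → Tt (S a b) → Coset y b
  coset-step = closed-trans

  coset-rel : ∀ {y a b} → Coset y a → Coset y b → Tt (S a b)
  coset-rel a∈ b∈ = closed-trans (closed-sym a∈) b∈

  σ : Fin nY → Fin nY → Fin mS
  σ y₁ y₂ = S (iY y₁) (iY y₂)

  -- uses |t(ui)| = 1
  σ-after-unique : ∀ y₁ y₂ {a b c a' b' c'} → Tt (S a b) → S a b ≡ S a' b' →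
                   S b c ≡ σ y₁ y₂ → S b' c' ≡ σ y₁ y₂ → S a c ≡ S a' c'
  σ-after-unique y₁ y₂ {a} {b} {c} {a'} {b'} {c'} t ab≡a'b' bc b'c' =
    let _ , _ , unique = single y₁ y₂ (S a b) t
    in trans (unique (S a c) (a , c , b , refl , refl , bc))
             (sym (unique (S a' c') (a' , c' , b' , refl , sym ab≡a'b' , b'c')))

  σ-before-unique : ∀ y₁ y₂ {a b c a' b' c'} → Tt (S b c) → S b c ≡ S b' c' →
                    S a b ≡ σ y₁ y₂ → S a' b' ≡ σ y₁ y₂ → S a c ≡ S a' c'
  σ-before-unique y₁ y₂ t bc≡b'c' ab a'b' =
    S-converse (σ-after-unique y₂ y₁ (closed-sym t) (S-converse bc≡b'c') (S-converse ab) (S-converse a'b'))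

  -- iπ is injective on relations and i is a morphism
  σ-cosets : ∀ y₁ y₂ y₁' y₂' {a b a' b'} → Coset y₁ a → Coset y₂ b → Coset y₁' a' → Coset y₂' b' →
             S a b ≡ S a' b' → σ y₁ y₂ ≡ σ y₁' y₂'
  σ-cosets y₁ y₂ y₁' y₂' {a} {b} {a'} {b'} a∈ b∈ a'∈ b'∈ ab≡a'b' =
    imorph y₁ y₂ y₁' y₂' (proj₂ (iπrel y₁ y₂ y₁' y₂')
      (S a b , (a , b , a∈ , b∈ , refl) , (a' , b' , a'∈ , b'∈ , sym ab≡a'b')))

  σ-successor : ∀ y₁ y₂ {a} → Coset y₁ a → ∃[ b ] (Coset y₂ b × S a b ≡ σ y₁ y₂)
  σ-successor y₁ y₂ {a} a∈ =
    let q , i₁q = Occ-from (a , iY y₂ , refl) (iY y₁)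
        y' , q∈ = iπsurj q
        b , ab , b-y' = S-transfer i₁q
                          (sym (σ-cosets y₁ y₂ y₁ y' a∈ (base∈coset y₂) (base∈coset y₁) q∈ (sym i₁q))) refl
    in b , closed-sym (subst Tt (sym b-y') q∈) , ab

  σ-predecessor : ∀ y₁ y₂ {b} → Coset y₂ b → ∃[ a ] (Coset y₁ a × S a b ≡ σ y₁ y₂)
  σ-predecessor y₁ y₂ b∈ = let a , a∈ , ba = σ-successor y₂ y₁ b∈ in a , a∈ , S-converse ba

  Tt′ Tt″ : Fin nY → Fin nY → Sub mS
  Tt′ y₁ y₂ = TtP S Tt (σ y₁ y₂)
  Tt″ y₁ y₂ = TtPP S Tt (σ y₁ y₂)

  Tt′-absorb : ∀ {y₁ y₂ a a' b} → Tt′ y₁ y₂ (S a a') → S a' b ≡ σ y₁ y₂ → S a b ≡ σ y₁ y₂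
  Tt′-absorb {a = a} {a'} {b} (_ , fix) a'b = proj₁ (fix (S a b)) (a , b , a' , refl , refl , a'b)

  Tt″-absorb : ∀ {y₁ y₂ a b b'} → Tt″ y₁ y₂ (S b b') → S a b ≡ σ y₁ y₂ → S a b' ≡ σ y₁ y₂
  Tt″-absorb {a = a} {b} {b'} (_ , fix) ab = proj₁ (fix (S a b')) (a , b' , b , refl , ab , refl)

  Tt′-intro : ∀ y₁ y₂ {a a' b} → Tt (S a a') → S a b ≡ σ y₁ y₂ → S a' b ≡ σ y₁ y₂ → Tt′ y₁ y₂ (S a a')
  Tt′-intro y₁ y₂ {a} {a'} {b} t ab a'b = t , λ r →
    (λ { (x , y , z , xy , xz , zy) →
         trans (sym xy) (trans (σ-after-unique y₁ y₂ (subst Tt (sym xz) t) xz zy a'b) ab) }) ,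
    (λ { refl → a , b , a' , ab , refl , a'b })

  Tt″-intro : ∀ y₁ y₂ {a b b'} → Tt (S b b') → S a b ≡ σ y₁ y₂ → S a b' ≡ σ y₁ y₂ → Tt″ y₁ y₂ (S b b')
  Tt″-intro y₁ y₂ {a} {b} {b'} t ab ab' = t , λ r →
    (λ { (x , y , z , xy , xz , zy) →
         trans (sym xy) (trans (σ-before-unique y₁ y₂ (subst Tt (sym zy) t) zy xz ab) ab') }) ,
    (λ { refl → a , b' , b , ab' , ab , refl })

  Tt′-diag : ∀ y₁ y₂ z → Tt′ y₁ y₂ (S z z)
  Tt′-diag y₁ y₂ z = subst (Tt′ y₁ y₂) (S-diag-≡ (iY y₁) z) (Tt′-intro y₁ y₂ (base∈coset y₁) refl refl)

  Tt″-diag : ∀ y₁ y₂ z → Tt″ y₁ y₂ (S z z)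
  Tt″-diag y₁ y₂ z = subst (Tt″ y₁ y₂) (S-diag-≡ (iY y₂) z) (Tt″-intro y₁ y₂ (base∈coset y₂) refl refl)

  Tt′-sym : ∀ y₁ y₂ {a a'} → Coset y₁ a' → Tt′ y₁ y₂ (S a a') → Tt′ y₁ y₂ (S a' a)
  Tt′-sym y₁ y₂ a'∈ t′ =
    let b , _ , a'b = σ-successor y₁ y₂ a'∈
    in Tt′-intro y₁ y₂ (closed-sym (proj₁ t′)) a'b (Tt′-absorb t′ a'b)

  Tt″-sym : ∀ y₁ y₂ {b b'} → Coset y₂ b → Tt″ y₁ y₂ (S b b') → Tt″ y₁ y₂ (S b' b)
  Tt″-sym y₁ y₂ b∈ t″ =
    let a , _ , ab = σ-predecessor y₁ y₂ b∈
    in Tt″-intro y₁ y₂ (closed-sym (proj₁ t″)) (Tt″-absorb t″ ab) ab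

  Tt′-trans : ∀ y₁ y₂ {a c b} → Coset y₁ b → Tt′ y₁ y₂ (S a c) → Tt′ y₁ y₂ (S c b) → Tt′ y₁ y₂ (S a b)
  Tt′-trans y₁ y₂ b∈ t′ t′' =
    let d , _ , bd = σ-successor y₁ y₂ b∈
    in Tt′-intro y₁ y₂ (closed-trans (proj₁ t′) (proj₁ t′')) (Tt′-absorb t′ (Tt′-absorb t′' bd)) bd

  Tt′-commuteʳ : ∀ y₁ y₂ {u w v} → Coset y₁ w → Coset y₁ v → Tt′ y₁ y₂ (S u w) →
                 ∃[ v' ] (S u v' ≡ S w v × Tt′ y₁ y₂ (S v' v))
  Tt′-commuteʳ y₁ y₂ {u} {w} {v} w∈ v∈ t′ =
    let b , b∈ , vb = σ-successor y₁ y₂ v∈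
        b' , b'∈ , wb' = σ-successor y₁ y₂ w∈
        v' , uv' , v'b = S-transfer
          (sym (σ-before-unique y₁ y₂ (coset-rel b'∈ b∈) refl (Tt′-absorb t′ wb') wb')) refl refl
        t-uv' = subst Tt (sym uv') (coset-rel w∈ v∈)
    in v' , uv' , Tt′-intro y₁ y₂ (closed-trans (closed-sym t-uv') (closed-trans (proj₁ t′) (coset-rel w∈ v∈)))
                    (trans v'b vb) vb

  Tt′-commuteˡ : ∀ y₁ y₂ {u w v} → Coset y₁ u → Coset y₁ w → Coset y₁ v → Tt′ y₁ y₂ (S w v) →
                 ∃[ w' ] (Tt′ y₁ y₂ (S u w') × S w' v ≡ S u w)
  Tt′-commuteˡ y₁ y₂ u∈ w∈ v∈ t′ =
    let w' , vw' , t′' = Tt′-commuteʳ y₁ y₂ w∈ u∈ (Tt′-sym y₁ y₂ v∈ t′)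
    in w' , Tt′-sym y₁ y₂ u∈ t′' , S-converse vw'

  Tt″-transport : ∀ y₁ y₂ {x₁ x₂ x₁' x₂' w₁ w₂ w₁' w₂'} → Coset y₁ x₁ → Coset y₁ x₂ →
                  Coset y₂ w₁ → Coset y₂ w₂ → Coset y₂ w₁' → Coset y₂ w₂' →
                  S x₁ x₂ ≡ S x₁' x₂' → S x₁ w₁ ≡ σ y₁ y₂ → S x₂ w₂ ≡ σ y₁ y₂ →
                  S x₁' w₁' ≡ σ y₁ y₂ → S x₂' w₂' ≡ σ y₁ y₂ →
                  ∃[ e ] (Coset y₂ e × Tt″ y₁ y₂ (S w₁' e) × S e w₂' ≡ S w₁ w₂)
  Tt″-transport y₁ y₂ x₁∈ x₂∈ w₁∈ w₂∈ w₁'∈ w₂'∈ x≡x' x₁w₁ x₂w₂ x₁'w₁' x₂'w₂' =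
    let e , x₁'e , ew₂' = S-transfer (σ-after-unique y₁ y₂ (coset-rel x₁∈ x₂∈) x≡x' x₂w₂ x₂'w₂') x₁w₁ refl
        e∈ = coset-step w₂'∈ (closed-sym (subst Tt (sym ew₂') (coset-rel w₁∈ w₂∈)))
    in e , e∈ , Tt″-intro y₁ y₂ (coset-rel w₁'∈ e∈) x₁'w₁' x₁'e , ew₂'

  σ-factor : ∀ y₁ y₂ y₃ {a} → Coset y₁ a → S a (iY y₃) ≡ σ y₁ y₃ →
             ∃[ b ] (Coset y₂ b × S a b ≡ σ y₁ y₂ × S b (iY y₃) ≡ σ y₂ y₃)
  σ-factor y₁ y₂ y₃ {a} a∈ a-i₃ =
    let c , ac , c-i₃ = S-transfer (sym a-i₃) refl refl
        y' , c∈ = iπsurj c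
        b , b∈ , ab = σ-successor y₁ y₂ a∈
        p , i₁p , pb = S-transfer (sym (σ-after-unique y₁ y₂ a∈ refl ab ac))
                         (σ-cosets y₁ y' y₁ y₂ a∈ c∈ (base∈coset y₁) (base∈coset y₂) ac) refl
        p∈ = coset-step b∈ (closed-sym (subst Tt (sym pb) c∈))
        t′ = subst (Tt′ y₂ y₃) (sym pb)
               (Tt′-intro y₂ y₃ c∈ (σ-cosets y' y₃ y₂ y₃ c∈ (base∈coset y₃) (base∈coset y₂) (base∈coset y₃) c-i₃) c-i₃)
        b' , t′' , b'b = Tt′-commuteˡ y₂ y₃ (base∈coset y₂) p∈ b∈ t′
        b'∈ = proj₁ t′'
        t″ = Tt″-sym y₁ y₂ b'∈ (subst (Tt″ y₁ y₂) (sym b'b) (Tt″-intro y₁ y₂ (coset-rel (base∈coset y₂) p∈) refl i₁p))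
    in b' , b'∈ , Tt″-absorb t″ ab , Tt′-absorb (Tt′-sym y₂ y₃ b'∈ t′') refl

  GD-functional : ∀ {t s s'} → GD T S γX t s → GD T S γX t s' → s ≡ s'
  GD-functional (x₁ , x₂ , t₁ , s₁) (u₁ , u₂ , t₂ , s₂) =
    trans (sym s₁) (trans (proj₁ (γrel x₁ x₂ u₁ u₂) (trans t₁ (sym t₂))) s₂)

  GD-⟺ : ∀ {t s} → GD T S γX t s → ∀ x w → (T x w ≡ t) ⟺ (S (γX x) (γX w) ≡ s)
  GD-⟺ (u₁ , u₂ , t₁ , s₁) x w =
    (λ xw → trans (proj₁ (γrel x w u₁ u₂) (trans xw (sym t₁))) s₁) ,
    (λ xw → trans (proj₂ (γrel x w u₁ u₂) (trans xw (sym s₁))) t₁)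

  GD-Tt : ∀ {t s} → GD T S γX t s → Tt s
  GD-Tt (u₁ , u₂ , _ , s₁) = subst Tt s₁ (closed-trans (closed-sym (γinto u₁)) (γinto u₂))

  γ-realise : ∀ {s} → Tt s → ∃[ x ] (S (γX x*) (γX x) ≡ s)
  γ-realise {s} t =
    let z , z*z = Occ-from (TtSub s t) z*
        x , γx = γonto z (subst Tt (sym z*z) t)
    in x , trans (cong₂ S γbased γx) z*z

  γs-realise : ∀ y {s} → Tt s → ∃[ x ] (S (iY y) (γs y x) ≡ s)
  γs-realise y {s} t =
    let z , iz = Occ-from (TtSub s t) (iY y)
        x , γx = cOnto y z (subst Tt (sym iz) t)
    in x , trans (cong (S (iY y)) γx) iz

  Tʸ : Fin nY → Rel nX mS
  Tʸ = Ty S γs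

  T′ T″ : Fin nY → Fin nY → Sub mS
  T′ = TP T S Tt γX iY
  T″ = TPP T S Tt γX iY

  Occ-Ty : ∀ y {s} → Tt s → Occ (Tʸ y) s
  Occ-Ty y t = let x , ix = γs-realise y t in x* , x , trans (cong (λ k → S k (γs y x)) (cBased y)) ix

  T′⇒Tt′ : ∀ {y₁ y₂ s} → T′ y₁ y₂ s → Tt′ y₁ y₂ s
  T′⇒Tt′ (_ , (_ , _ , gd , t′) , (_ , gd')) = subst (Tt′ _ _) (GD-functional gd gd') t′

  T″⇒Tt″ : ∀ {y₁ y₂ s} → T″ y₁ y₂ s → Tt″ y₁ y₂ s
  T″⇒Tt″ (_ , (_ , _ , gd , t″) , (_ , gd')) = subst (Tt″ _ _) (GD-functional gd gd') t″

  Tt′⇒T′ : ∀ {y₁ y₂ s} → Tt′ y₁ y₂ s → T′ y₁ y₂ s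
  Tt′⇒T′ {s = s} t′ =
    let x , γx = γ-realise (proj₁ t′)
    in T x* x , ((x* , x , refl) , s , (x* , x , refl , γx) , t′) , ((x* , x , refl) , (x* , x , refl , γx))

  Tt″⇒T″ : ∀ {y₁ y₂ s} → Tt″ y₁ y₂ s → T″ y₁ y₂ s
  Tt″⇒T″ {s = s} t″ =
    let x , γx = γ-realise (proj₁ t″)
    in T x* x , ((x* , x , refl) , s , (x* , x , refl , γx) , t″) , ((x* , x , refl) , (x* , x , refl , γx))

  Tt″⇒Tt′ : ∀ y₁ y₂ {s} → Tt″ y₁ y₂ s → Tt′ y₂ y₁ s
  Tt″⇒Tt′ y₁ y₂ t″ =
    let x , ix = γs-realise y₂ (proj₁ t″)
        i₁x = Tt″-absorb {y₁} {y₂} {iY y₁} (subst (Tt″ y₁ y₂) (sym ix) t″) refl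
    in subst (Tt′ y₂ y₁) ix (Tt′-intro y₂ y₁ (coset-rel (base∈coset y₂) (cInto y₂ x)) refl (S-converse i₁x))

  Tt′⇒Tt″ : ∀ y₁ y₂ {s} → Tt′ y₂ y₁ s → Tt″ y₁ y₂ s
  Tt′⇒Tt″ y₁ y₂ t′ =
    let x , ix = γs-realise y₂ (proj₁ t′)
        xi₁ = Tt′-absorb (Tt′-sym y₂ y₁ (cInto y₂ x) (subst (Tt′ y₂ y₁) (sym ix) t′)) refl
    in subst (Tt″ y₁ y₂) ix (Tt″-intro y₁ y₂ (coset-rel (base∈coset y₂) (cInto y₂ x)) refl (S-converse xi₁))

  ζ : Fin nY → Fin nY → PreHom nX mS nX mS
  ζ = ζC T S Tt γX iY γs

  ζ-map⇒σ : ∀ y₁ y₂ {x x'} → map (ζ y₁ y₂) x x' → S (γs y₁ x) (γs y₂ x') ≡ σ y₁ y₂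
  ζ-map⇒σ y₁ y₂ (_ , _ , xz , _ , refl , t″) = Tt″-absorb (T″⇒Tt″ t″) xz

  σ⇒ζ-map : ∀ y₁ y₂ {x x'} → S (γs y₁ x) (γs y₂ x') ≡ σ y₁ y₂ → map (ζ y₁ y₂) x x'
  σ⇒ζ-map y₁ y₂ {x' = x'} xx' = γs y₂ x' , x' , xx' , cInto y₂ x' , refl , Tt″⇒T″ (Tt″-diag y₁ y₂ _)

  T′-closed : ∀ y₁ y₂ → Closed (Tʸ y₁) (T′ y₁ y₂)
  T′-closed y₁ y₂ p p' q r p∈ (u , v , uv , vu) q∈ (x , y , z , xy , xz , zy) =
    let t′-zx = subst (Tt′ y₁ y₂) (sym (trans (S-converse (trans xz (sym vu))) uv)) (T′⇒Tt′ p∈)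
        t′-zy = subst (Tt′ y₁ y₂) (sym zy) (T′⇒Tt′ q∈)
        t′-xy = Tt′-trans y₁ y₂ (cInto y₁ y) (Tt′-sym y₁ y₂ (cInto y₁ x) t′-zx) t′-zy
    in Tt′⇒T′ (subst (Tt′ y₁ y₂) xy t′-xy)

  T′-normalˡ : ∀ y₁ y₂ {p r} → ∃[ t ] (T′ y₁ y₂ t × PosA (Tʸ y₁) p t r) →
               ∃[ t ] (T′ y₁ y₂ t × PosA (Tʸ y₁) t p r)
  T′-normalˡ y₁ y₂ (t , t∈ , (x , y , z , xy , xz , zy)) =
    let w , t′ , wy = Tt′-commuteˡ y₁ y₂ (cInto y₁ x) (cInto y₁ z) (cInto y₁ y)
                        (subst (Tt′ y₁ y₂) (sym zy) (T′⇒Tt′ t∈))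
        k , γk = cOnto y₁ w (coset-step (cInto y₁ x) (proj₁ t′))
    in S (γs y₁ x) (γs y₁ k) , Tt′⇒T′ (subst (λ w → Tt′ y₁ y₂ (S (γs y₁ x) w)) (sym γk) t′) ,
       (x , y , k , xy , refl , trans (cong (λ w → S w (γs y₁ y)) γk) (trans wy xz))

  T′-normalʳ : ∀ y₁ y₂ {p r} → ∃[ t ] (T′ y₁ y₂ t × PosA (Tʸ y₁) t p r) →
               ∃[ t ] (T′ y₁ y₂ t × PosA (Tʸ y₁) p t r)
  T′-normalʳ y₁ y₂ (t , t∈ , (x , y , z , xy , xz , zy)) =
    let w , xw , t′ = Tt′-commuteʳ y₁ y₂ (cInto y₁ z) (cInto y₁ y)
                        (subst (Tt′ y₁ y₂) (sym xz) (T′⇒Tt′ t∈))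
        k , γk = cOnto y₁ w (coset-step (cInto y₁ x) (subst Tt (sym xw) (coset-rel (cInto y₁ z) (cInto y₁ y))))
    in S (γs y₁ k) (γs y₁ y) , Tt′⇒T′ (subst (λ w → Tt′ y₁ y₂ (S w (γs y₁ y))) (sym γk) t′) ,
       (x , y , k , xy , trans (cong (S (γs y₁ x)) γk) (trans xw zy) , refl)

  T′-normal : ∀ y₁ y₂ → Normal (Tʸ y₁) (T′ y₁ y₂)
  T′-normal y₁ y₂ _ _ _ = T′-normalˡ y₁ y₂ , T′-normalʳ y₁ y₂

  T″⇔T′ : ∀ y₁ y₂ s → T″ y₁ y₂ s ⟺ T′ y₂ y₁ s
  T″⇔T′ y₁ y₂ s = (λ t → Tt′⇒T′ (Tt″⇒Tt′ y₁ y₂ (T″⇒Tt″ t))) , (λ t → Tt″⇒T″ (Tt′⇒Tt″ y₁ y₂ (T′⇒Tt′ t)))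

  T″-closed : ∀ y₁ y₂ → Closed (Tʸ y₂) (T″ y₁ y₂)
  T″-closed y₁ y₂ p p' q r p∈ p* q∈ pq =
    proj₂ (T″⇔T′ y₁ y₂ r) (T′-closed y₂ y₁ p p' q r (proj₁ (T″⇔T′ y₁ y₂ p) p∈) p* (proj₁ (T″⇔T′ y₁ y₂ q) q∈) pq)

  T″-normal : ∀ y₁ y₂ → Normal (Tʸ y₂) (T″ y₁ y₂)
  T″-normal y₁ y₂ _ _ _ = via (T′-normalˡ y₂ y₁) , via (T′-normalʳ y₂ y₁)
    where
    via : ∀ {P Q : Fin mS → Set} →
          (∃[ t ] (T′ y₂ y₁ t × P t) → ∃[ t ] (T′ y₂ y₁ t × Q t)) →
          ∃[ t ] (T″ y₁ y₂ t × P t) → ∃[ t ] (T″ y₁ y₂ t × Q t)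
    via normal (t , t∈ , pt) =
      let t' , t'∈ , qt' = normal (t , proj₁ (T″⇔T′ y₁ y₂ t) t∈ , pt)
      in t' , proj₂ (T″⇔T′ y₁ y₂ t') t'∈ , qt'

  ζ-map-T′ : ∀ y₁ y₂ {x a w} → T′ y₁ y₂ (Tʸ y₁ x a) → map (ζ y₁ y₂) x w → S (γs y₁ a) (γs y₂ w) ≡ σ y₁ y₂
  ζ-map-T′ y₁ y₂ {a = a} xa m = Tt′-absorb (Tt′-sym y₁ y₂ (cInto y₁ a) (T′⇒Tt′ xa)) (ζ-map⇒σ y₁ y₂ m)

  ζ-map-T″ : ∀ y₁ y₂ {x w e} → T″ y₁ y₂ (Tʸ y₂ w e) → map (ζ y₁ y₂) x w → S (γs y₁ x) (γs y₂ e) ≡ σ y₁ y₂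
  ζ-map-T″ y₁ y₂ we m = Tt″-absorb (T″⇒Tt″ we) (ζ-map⇒σ y₁ y₂ m)

  ζ-total : ∀ y₁ y₂ x → ∃[ w ] map (ζ y₁ y₂) x w
  ζ-total y₁ y₂ x =
    let b , b∈ , xb = σ-successor y₁ y₂ (cInto y₁ x)
        w , γw = cOnto y₂ b b∈
    in w , σ⇒ζ-map y₁ y₂ (trans (cong (S (γs y₁ x)) γw) xb)

  ζ-surjective : ∀ y₁ y₂ w → ∃[ x ] map (ζ y₁ y₂) x w
  ζ-surjective y₁ y₂ w =
    let a , a∈ , aw = σ-predecessor y₁ y₂ (cInto y₂ w)
        x , γx = cOnto y₁ a a∈
    in x , σ⇒ζ-map y₁ y₂ (trans (cong (λ k → S k (γs y₂ w)) γx) aw)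

  module _ (y₁ y₂ : Fin nY) {x₁ x₂ x₁' x₂' w₁ w₂ w₁' w₂' : Fin nX}
           (m₁ : map (ζ y₁ y₂) x₁ w₁) (m₂ : map (ζ y₁ y₂) x₂ w₂)
           (m₁' : map (ζ y₁ y₂) x₁' w₁') (m₂' : map (ζ y₁ y₂) x₂' w₂') where

    ζ-iso→ : ∃[ s ] (InQ (Tʸ y₁) (T′ y₁ y₂) s x₁ x₂ × InQ (Tʸ y₁) (T′ y₁ y₂) s x₁' x₂') →
             ∃[ u ] (InQ (Tʸ y₂) (T″ y₁ y₂) u w₁ w₂ × InQ (Tʸ y₂) (T″ y₁ y₂) u w₁' w₂')
    ζ-iso→ (_ , (a , b , x₁a , x₂b , ab) , (a' , b' , x₁'a' , x₂'b' , a'b')) =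
      let e , e∈ , t″ , ew₂' = Tt″-transport y₁ y₂ (cInto y₁ a) (cInto y₁ b)
                                 (cInto y₂ w₁) (cInto y₂ w₂) (cInto y₂ w₁') (cInto y₂ w₂')
                                 (trans ab (sym a'b'))
                                 (ζ-map-T′ y₁ y₂ x₁a m₁) (ζ-map-T′ y₁ y₂ x₂b m₂)
                                 (ζ-map-T′ y₁ y₂ x₁'a' m₁') (ζ-map-T′ y₁ y₂ x₂'b' m₂')
          k , γk = cOnto y₂ e e∈
      in Tʸ y₂ w₁ w₂ ,
         (w₁ , w₂ , Tt″⇒T″ (Tt″-diag y₁ y₂ _) , Tt″⇒T″ (Tt″-diag y₁ y₂ _) , refl) ,
         (k , w₂' , Tt″⇒T″ (subst (λ z → Tt″ y₁ y₂ (S (γs y₂ w₁') z)) (sym γk) t″) ,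
          Tt″⇒T″ (Tt″-diag y₁ y₂ _) , trans (cong (λ z → S z (γs y₂ w₂')) γk) ew₂')

    ζ-iso← : ∃[ u ] (InQ (Tʸ y₂) (T″ y₁ y₂) u w₁ w₂ × InQ (Tʸ y₂) (T″ y₁ y₂) u w₁' w₂') →
             ∃[ s ] (InQ (Tʸ y₁) (T′ y₁ y₂) s x₁ x₂ × InQ (Tʸ y₁) (T′ y₁ y₂) s x₁' x₂')
    ζ-iso← (_ , (p , q , w₁p , w₂q , pq) , (p' , q' , w₁'p' , w₂'q' , p'q')) =
      let e , e∈ , t″ , ex₂' = Tt″-transport y₂ y₁ (cInto y₂ p) (cInto y₂ q)
                                 (cInto y₁ x₁) (cInto y₁ x₂) (cInto y₁ x₁') (cInto y₁ x₂')
                                 (trans pq (sym p'q'))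
                                 (S-converse (ζ-map-T″ y₁ y₂ w₁p m₁)) (S-converse (ζ-map-T″ y₁ y₂ w₂q m₂))
                                 (S-converse (ζ-map-T″ y₁ y₂ w₁'p' m₁')) (S-converse (ζ-map-T″ y₁ y₂ w₂'q' m₂'))
          k , γk = cOnto y₁ e e∈
      in Tʸ y₁ x₁ x₂ ,
         (x₁ , x₂ , Tt′⇒T′ (Tt′-diag y₁ y₂ _) , Tt′⇒T′ (Tt′-diag y₁ y₂ _) , refl) ,
         (k , x₂' , Tt′⇒T′ (subst (λ z → Tt′ y₁ y₂ (S (γs y₁ x₁') z)) (sym γk) (Tt″⇒Tt′ y₂ y₁ t″)) ,
          Tt′⇒T′ (Tt′-diag y₁ y₂ _) , trans (cong (λ z → S z (γs y₁ x₂')) γk) ex₂')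

  ζ-homC : ∀ y₁ y₂ → IsHomC (Tʸ y₁) x* (Tʸ y₂) x* (ζ y₁ y₂)
  ζ-homC y₁ y₂ = record
    { domSub    = λ s t → Occ-Ty y₁ (proj₁ (T′⇒Tt′ t))
    ; domClosed = T′-closed y₁ y₂
    ; domNormal = T′-normal y₁ y₂
    ; codSub    = λ s t → Occ-Ty y₂ (proj₁ (T″⇒Tt″ t))
    ; codClosed = T″-closed y₁ y₂
    ; codNormal = T″-normal y₁ y₂
    ; total     = ζ-total y₁ y₂
    ; coset     = λ x w w' m →
        (λ m' → Tt″⇒T″ (Tt″-intro y₁ y₂ (coset-rel (cInto y₂ w) (cInto y₂ w')) (ζ-map⇒σ y₁ y₂ m) (ζ-map⇒σ y₁ y₂ m'))) ,
        (λ ww' → σ⇒ζ-map y₁ y₂ (ζ-map-T″ y₁ y₂ ww' m))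
    ; respects  = λ x x' xx' w →
        (λ m → σ⇒ζ-map y₁ y₂ (ζ-map-T′ y₁ y₂ xx' m)) ,
        (λ m → σ⇒ζ-map y₁ y₂ (Tt′-absorb (T′⇒Tt′ xx') (ζ-map⇒σ y₁ y₂ m)))
    ; injective = λ x x' w m m' →
        Tt′⇒T′ (Tt′-intro y₁ y₂ (coset-rel (cInto y₁ x) (cInto y₁ x')) (ζ-map⇒σ y₁ y₂ m) (ζ-map⇒σ y₁ y₂ m'))
    ; surjective = ζ-surjective y₁ y₂
    ; based     = σ⇒ζ-map y₁ y₂ (cong₂ S (cBased y₁) (cBased y₂))
    ; iso       = λ _ _ _ _ _ _ _ _ m₁ m₂ m₁' m₂' → ζ-iso→ y₁ y₂ m₁ m₂ m₁' m₂' , ζ-iso← y₁ y₂ m₁ m₂ m₁' m₂'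
    }

  module OnBaseCoset = CosetRestriction schS TtClosed z* γX γinj γinto γonto
  module OnCoset (y : Fin nY) = CosetRestriction schS TtClosed (iY y) (γs y) (cInj y) (cInto y) (cOnto y)

  α : Fin nY → Fin mT → Fin mS → Set
  α = αC T S γX

  α-const : ∀ y p q r p' q' r' → α y p p' → α y q q' → α y r r' →
            ∀ x₁ x₂ x₁' x₂' → T x₁ x₂ ≡ r → Tʸ y x₁' x₂' ≡ r' → cnt T x₁ x₂ p q ≡ cnt (Tʸ y) x₁' x₂' p' q'
  α-const y p q r p' q' r' (_ , gp) (_ , gq) (_ , gr) x₁ x₂ x₁' x₂' x₁x₂ x₁'x₂' = begin
    cnt T x₁ x₂ p q                     ≡⟨ count-cong along-γ ⟩
    cnt OnBaseCoset.Sʰ x₁ x₂ p' q'      ≡⟨ OnBaseCoset.Sʰ-cnt x₁ x₂ p' q' (GD-Tt gp) ⟩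
    cnt S (γX x₁) (γX x₂) p' q'         ≡⟨ IsScheme.regular schS _ _ _ _ γx₁x₂≡ p' q' ⟩
    cnt S (γs y x₁') (γs y x₂') p' q'   ≡⟨ OnCoset.Sʰ-cnt y x₁' x₂' p' q' (GD-Tt gp) ⟨
    cnt (Tʸ y) x₁' x₂' p' q' ∎
    where
    open ≡-Reasoning
    γx₁x₂≡ : S (γX x₁) (γX x₂) ≡ S (γs y x₁') (γs y x₂')
    γx₁x₂≡ = trans (proj₁ (GD-⟺ gr x₁ x₂) x₁x₂) (sym x₁'x₂')
    along-γ : ∀ w → (⌊ T x₁ w ≟ p ⌋ ∧ ⌊ T w x₂ ≟ q ⌋) ≡ (⌊ OnBaseCoset.Sʰ x₁ w ≟ p' ⌋ ∧ ⌊ OnBaseCoset.Sʰ w x₂ ≟ q' ⌋)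
    along-γ w = cong₂ _∧_ (⌊⌋-cong (T x₁ w ≟ p) (OnBaseCoset.Sʰ x₁ w ≟ p') (GD-⟺ gp x₁ w))
                          (⌊⌋-cong (T w x₂ ≟ q) (OnBaseCoset.Sʰ w x₂ ≟ q') (GD-⟺ gq w x₂))

  τ-scheme : ∀ y → IsTauScheme T x* (Tʸ y) (α y)
  τ-scheme y = record
    { scheme = OnCoset.Sʰ-scheme y
    ; αtotal = λ { t (u , v , uv) → S (γX u) (γX v) , (u , v , uv) , (u , v , uv , refl) }
    ; αdom   = λ _ _ → proj₁
    ; αcod   = λ { _ _ (_ , gd) → Occ-Ty y (GD-Tt gd) }
    ; αfun   = λ _ _ _ a a' → GD-functional (proj₂ a) (proj₂ a')
    ; αinj   = λ { _ _ _ (_ , (u , v , uv , γuv)) (_ , (u' , v' , u'v' , γu'v')) →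
                   trans (sym uv) (trans (proj₂ (γrel u v u' v') (trans γuv (sym γu'v'))) u'v') }
    ; αsurj  = α-surj
    ; αone   = α-one
    ; αstar  = α-star
    ; αconst = α-const y
    }
    where
    open IsScheme schT using () renaming (diagonal to diagonalT)

    α-surj : ∀ s → Occ (Tʸ y) s → ∃[ t ] α y t s
    α-surj s (x₁ , x₂ , x₁x₂) =
      let x , γx = γ-realise (subst Tt x₁x₂ (coset-rel (cInto y x₁) (cInto y x₂)))
      in T x* x , (x* , x , refl) , (x* , x , refl , γx)

    α-one : ∀ s → α y (T x* x*) s → ∀ x₁ x₂ → (Tʸ y x₁ x₂ ≡ s) ⟺ (x₁ ≡ x₂)
    α-one s (_ , (u , v , uv , γuv)) x₁ x₂ =
      (λ x₁x₂ → cInj y x₁ x₂ (S-diag-inj (trans x₁x₂ s≡𝟙))) ,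
      (λ { refl → trans (S-diag _) (sym s≡𝟙) })
      where
      u≡v : u ≡ v
      u≡v = proj₁ (proj₂ diagonalT u v) (trans uv (proj₂ (proj₂ diagonalT x* x*) refl))
      s≡𝟙 : s ≡ 𝟙
      s≡𝟙 = trans (sym γuv) (trans (cong (λ k → S (γX u) (γX k)) (sym u≡v)) (S-diag _))

    α-star : ∀ p q p' q' → IsStar T p q → α y p p' → α y q q' → IsStar (Tʸ y) p' q'
    α-star p q p' q' (u , v , uv , vu) (_ , gp) (_ , gq) =
      let x , ix = γs-realise y (GD-Tt gp)
          x*x = trans (cong (λ k → S k (γs y x)) (cBased y)) ix
      in x* , x , x*x ,
         trans (S-converse (trans x*x (sym (proj₁ (GD-⟺ gp u v) uv)))) (proj₁ (GD-⟺ gq v u) vu)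

  Tʸ*≡γ : ∀ x₁ x₂ → Tʸ y* x₁ x₂ ≡ S (γX x₁) (γX x₂)
  Tʸ*≡γ x₁ x₂ = cong₂ S (cStar x₁) (cStar x₂)

  ax1-T : ∀ x₁ x₂ x₁' x₂' → (Tʸ y* x₁ x₂ ≡ Tʸ y* x₁' x₂') ⟺ (T x₁ x₂ ≡ T x₁' x₂')
  ax1-T x₁ x₂ x₁' x₂' =
    (λ eq → proj₂ (γrel x₁ x₂ x₁' x₂') (trans (sym (Tʸ*≡γ x₁ x₂)) (trans eq (Tʸ*≡γ x₁' x₂')))) ,
    (λ eq → trans (Tʸ*≡γ x₁ x₂) (trans (proj₁ (γrel x₁ x₂ x₁' x₂') eq) (sym (Tʸ*≡γ x₁' x₂'))))

  ax1-α : ∀ t s x₁ x₂ → T x₁ x₂ ≡ t → (α y* t s ⟺ Tʸ y* x₁ x₂ ≡ s)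
  ax1-α t s x₁ x₂ x₁x₂ =
    (λ { (_ , gd) → trans (Tʸ*≡γ x₁ x₂) (proj₁ (GD-⟺ gd x₁ x₂) x₁x₂) }) ,
    (λ eq → (x₁ , x₂ , x₁x₂) , (x₁ , x₂ , x₁x₂ , trans (sym (Tʸ*≡γ x₁ x₂)) eq))

  ax2 : ∀ y → ζ y y ≈H idC (Tʸ y) x*
  ax2 y = (λ t → T′-trivial t , λ { refl → Tt′⇒T′ (Tt′-diag y y _) }) ,
          (λ t → T″-trivial t , λ { refl → Tt″⇒T″ (Tt″-diag y y _) }) ,
          (λ x x' → (λ m → cInj y x x' (S-diag-inj (trans (ζ-map⇒σ y y m) (S-diag _)))) ,
                    (λ { refl → σ⇒ζ-map y y (S-diag-≡ _ _) }))
    where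
    base≡σ : Tʸ y x* x* ≡ σ y y
    base≡σ = cong₂ S (cBased y) (cBased y)
    T′-trivial : ∀ t → T′ y y t → t ≡ Tʸ y x* x*
    T′-trivial t t∈ =
      let x , ix = γs-realise y (proj₁ (T′⇒Tt′ t∈))
      in trans (proj₁ (proj₂ (T′⇒Tt′ t∈) t) (iY y , γs y x , γs y x , ix , ix , S-diag-≡ _ _)) (sym base≡σ)
    T″-trivial : ∀ t → T″ y y t → t ≡ Tʸ y x* x*
    T″-trivial t t∈ =
      let x , ix = γs-realise y (proj₁ (T″⇒Tt″ t∈))
      in trans (proj₁ (proj₂ (T″⇒Tt″ t∈) t) (iY y , γs y x , iY y , ix , refl , ix)) (sym base≡σ)

  ax3 : ∀ y₁ y₂ → ζ y₂ y₁ ≈H starC (ζ y₁ y₂)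
  ax3 y₁ y₂ = (λ t → swap (T″⇔T′ y₁ y₂ t)) , (λ u → T″⇔T′ y₂ y₁ u) ,
              (λ x x' → (λ m → σ⇒ζ-map y₁ y₂ (S-converse (ζ-map⇒σ y₂ y₁ m))) ,
                        (λ m → σ⇒ζ-map y₂ y₁ (S-converse (ζ-map⇒σ y₁ y₂ m))))

  -- depends on σ = ui only, which gives axiom (4)
  Linked : Fin mS → Fin mS → Fin mS → Set
  Linked σ' s s' = Tt s × Tt s' × ∃[ ρ ] (PosA S s σ' ρ × PosA S σ' s' ρ)

  ζ-relates : Fin nY → Fin nY → Fin mS → Fin mS → Set
  ζ-relates y₁ y₂ = MapsRel (Tʸ y₁) (Tʸ y₂) (ζ y₁ y₂)

  ζ-relates⇒Linked : ∀ y₁ y₂ {s s'} → ζ-relates y₁ y₂ s s' → Linked (σ y₁ y₂) s s'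
  ζ-relates⇒Linked y₁ y₂
    (x₁ , x₂ , w₁ , w₂ , (a , b , x₁a , x₂b , ab) , m₁ , m₂ , (e₁ , e₂ , w₁e₁ , w₂e₂ , e₁e₂)) =
    subst Tt ab (coset-rel (cInto y₁ a) (cInto y₁ b)) ,
    subst Tt e₁e₂ (coset-rel (cInto y₂ e₁) (cInto y₂ e₂)) ,
    S (γs y₁ a) (γs y₂ e₂) ,
    (γs y₁ a , γs y₂ e₂ , γs y₁ b , refl , ab , ζ-map-T″ y₁ y₂ w₂e₂ (ζ-map-T′-σ x₂b m₂)) ,
    (γs y₁ a , γs y₂ e₂ , γs y₂ e₁ , refl , ζ-map-T″ y₁ y₂ w₁e₁ (ζ-map-T′-σ x₁a m₁) , e₁e₂)
    where
    ζ-map-T′-σ : ∀ {x a w} → T′ y₁ y₂ (Tʸ y₁ x a) → map (ζ y₁ y₂) x w → map (ζ y₁ y₂) a w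
    ζ-map-T′-σ xa m = σ⇒ζ-map y₁ y₂ (ζ-map-T′ y₁ y₂ xa m)

  Linked⇒ζ-relates : ∀ y₁ y₂ {s s'} → Linked (σ y₁ y₂) s s' → ζ-relates y₁ y₂ s s'
  Linked⇒ζ-relates y₁ y₂ {s} {s'} (s∈ , s'∈ , ρ , sσ , (x , y , z , xy , xz , zy)) =
    let b , ib = γs-realise y₁ s∈
        e₂ , e₂∈ , be₂ = σ-successor y₁ y₂ (cInto y₁ b)
        _ , _ , unique = single y₁ y₂ s s∈
        e₁ , ie₁ , e₁e₂ = S-transfer (trans xy (trans (unique ρ sσ)
                            (sym (unique (S (iY y₁) e₂) (iY y₁ , e₂ , γs y₁ b , refl , ib , be₂))))) xz zy
        k₁ , γk₁ = cOnto y₂ e₁ (coset-step e₂∈ (closed-sym (subst Tt (sym e₁e₂) s'∈)))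
        k₂ , γk₂ = cOnto y₂ e₂ e₂∈
    in x* , b , k₁ , k₂ ,
       (x* , b , Tt′⇒T′ (Tt′-diag y₁ y₂ _) , Tt′⇒T′ (Tt′-diag y₁ y₂ _) ,
        trans (cong (λ k → S k (γs y₁ b)) (cBased y₁)) ib) ,
       σ⇒ζ-map y₁ y₂ (trans (cong₂ S (cBased y₁) γk₁) ie₁) ,
       σ⇒ζ-map y₁ y₂ (trans (cong (S (γs y₁ b)) γk₂) be₂) ,
       (k₁ , k₂ , Tt″⇒T″ (Tt″-diag y₁ y₂ _) , Tt″⇒T″ (Tt″-diag y₁ y₂ _) , trans (cong₂ S γk₁ γk₂) e₁e₂)

  ax4 : ∀ y₁ y₂ y₁' y₂' → U y₁ y₂ ≡ U y₁' y₂' → ∀ P u →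
        PhiTau T (Tʸ y₁) (Tʸ y₂) (α y₁) (α y₂) (ζ y₁ y₂) P u
        ⟺ PhiTau T (Tʸ y₁') (Tʸ y₂') (α y₁') (α y₂') (ζ y₁' y₂') P u
  ax4 y₁ y₂ y₁' y₂' u≡u' P u = along (imorph y₁ y₂ y₁' y₂' u≡u') , along (sym (imorph y₁ y₂ y₁' y₂' u≡u'))
    where
    along : ∀ {y₁ y₂ y₁' y₂'} → σ y₁ y₂ ≡ σ y₁' y₂' →
            PhiTau T (Tʸ y₁) (Tʸ y₂) (α y₁) (α y₂) (ζ y₁ y₂) P u →
            PhiTau T (Tʸ y₁') (Tʸ y₂') (α y₁') (α y₂') (ζ y₁' y₂') P u
    along {y₁} {y₂} {y₁'} {y₂'} σ≡σ' (u-occ , t , s , s' , t∈P , t-occ , αts , αus' , rel) =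
      u-occ , t , s , s' , t∈P , t-occ , αts , αus' ,
      Linked⇒ζ-relates y₁' y₂' (subst (λ σ' → Linked σ' s s') σ≡σ' (ζ-relates⇒Linked y₁ y₂ rel))

  ζζ : Fin nY → Fin nY → Fin nY → PreHom nX mS nX mS
  ζζ y₁ y₂ y₃ = compC (Tʸ y₁) x* (Tʸ y₂) (Tʸ y₃) x* (ζ y₁ y₂) (ζ y₂ y₃)

  ζζ-dom-via : ∀ y₁ y₂ y₃ {a b t} → Tt t → Coset y₂ b →
               S (iY y₁) a ≡ t → S a b ≡ σ y₁ y₂ → S b (iY y₃) ≡ σ y₂ y₃ →
               ∃[ u ] (ζ-relates y₁ y₂ t u × ζ-relates y₂ y₃ u (Tʸ y₃ x* x*))
  ζζ-dom-via y₁ y₂ y₃ {a} {b} {t} t∈ b∈ i₁a ab b-i₃ =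
    S (iY y₂) b ,
    Linked⇒ζ-relates y₁ y₂ {t} {S (iY y₂) b} (t∈ , b∈ , S (iY y₁) b ,
      (iY y₁ , b , a , refl , i₁a , ab) ,
      (iY y₁ , b , iY y₂ , refl , refl , refl)) ,
    Linked⇒ζ-relates y₂ y₃ {S (iY y₂) b} {Tʸ y₃ x* x*} (b∈ , closed-diag b∈ _ , σ y₂ y₃ ,
      (iY y₂ , iY y₃ , b , refl , refl , b-i₃) ,
      (iY y₂ , iY y₃ , iY y₃ , refl , refl , S-diag-≡ _ _))

  ax5-dom : ∀ y₁ y₂ y₃ t → T′ y₁ y₃ t → dom (ζζ y₁ y₂ y₃) t
  ax5-dom y₁ y₂ y₃ t t∈ =
    let t′ = T′⇒Tt′ {y₁} {y₃} t∈
        a , ia = γs-realise y₁ (proj₁ t′)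
        a-i₃ = Tt′-absorb (Tt′-sym y₁ y₃ (cInto y₁ a) (subst (Tt′ y₁ y₃) (sym ia) t′)) refl
        b , b∈ , ab , b-i₃ = σ-factor y₁ y₂ y₃ (cInto y₁ a) a-i₃
    in Occ-Ty y₁ (proj₁ t′) , ζζ-dom-via y₁ y₂ y₃ {γs y₁ a} {b} {t} (proj₁ t′) b∈ ia ab b-i₃

  ζζ-cod-via : ∀ y₁ y₂ y₃ {b c v} → Coset y₂ b → Tt v →
               S c b ≡ σ y₃ y₂ → S b (iY y₁) ≡ σ y₂ y₁ → S (iY y₃) c ≡ v → cod (ζζ y₁ y₂ y₃) v
  ζζ-cod-via y₁ y₂ y₃ {b} {c} {v} b∈ v∈ cb b-i₁ i₃c =
    S (iY y₂) b ,
    Linked⇒ζ-relates y₁ y₂ {Tʸ y₁ x* x*} {S (iY y₂) b} (closed-diag b∈ _ , b∈ , S (iY y₁) b ,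
      (iY y₁ , b , iY y₁ , refl , S-diag-≡ _ _ , S-converse b-i₁) ,
      (iY y₁ , b , iY y₂ , refl , refl , refl)) ,
    Linked⇒ζ-relates y₂ y₃ {S (iY y₂) b} {v} (b∈ , v∈ , S (iY y₂) c ,
      (iY y₂ , c , b , refl , refl , S-converse cb) ,
      (iY y₂ , c , iY y₃ , refl , refl , i₃c))

  ax5-cod : ∀ y₁ y₂ y₃ v → T″ y₁ y₃ v → cod (ζζ y₁ y₂ y₃) v
  ax5-cod y₁ y₂ y₃ v v∈ =
    let t″ = T″⇒Tt″ {y₁} {y₃} v∈
        c , ic = γs-realise y₃ (proj₁ t″)
        i₁c = Tt″-absorb {y₁} {y₃} {iY y₁} (subst (Tt″ y₁ y₃) (sym ic) t″) refl
        b , b∈ , cb , b-i₁ = σ-factor y₃ y₂ y₁ (cInto y₃ c) (S-converse i₁c)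
    in ζζ-cod-via y₁ y₂ y₃ {b} {γs y₃ c} {v} b∈ (proj₁ t″) cb b-i₁ ic

  ζζ-cod-witness : ∀ y₁ y₂ y₃ {y' b b₁ d₁ c c₀} → Coset y₂ b → Coset y₃ c → Coset y₃ c₀ → Coset y' b₁ →
                   S (iY y₁) b₁ ≡ σ y₁ y₂ → S b₁ (iY y₃) ≡ S b c → S b₁ d₁ ≡ σ y₂ y₃ → S d₁ (iY y₃) ≡ S c₀ c →
                   ∃[ u ] (ζ-relates y₁ y₂ (Tʸ y₁ x* x*) u × ζ-relates y₂ y₃ u (S c₀ c))
  ζζ-cod-witness y₁ y₂ y₃ {y'} {b} {b₁} {d₁} {c} {c₀} b∈ c∈ c₀∈ b₁∈ i₁b₁ b₁-i₃ b₁d₁ d₁-i₃ =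
    S b₁ (iY y') ,
    Linked⇒ζ-relates y₁ y₂ {Tʸ y₁ x* x*} {S b₁ (iY y')} (closed-diag b∈ _ , closed-sym b₁∈ , σ y₁ y₂ ,
      (iY y₁ , iY y₂ , iY y₁ , refl , S-diag-≡ _ _ , refl) ,
      (iY y₁ , iY y' , b₁ ,
       σ-cosets y₁ y' y₁ y₂ (base∈coset y₁) b₁∈ (base∈coset y₁) (base∈coset y₂) i₁b₁ , i₁b₁ , refl)) ,
    Linked⇒ζ-relates y₂ y₃ {S b₁ (iY y')} {S c₀ c} (closed-sym b₁∈ , coset-rel c₀∈ c∈ , S b₁ (iY y₃) ,
      (b₁ , iY y₃ , iY y' , refl , refl , σ-cosets y' y₃ y₂ y₃ b₁∈ (base∈coset y₃) b∈ c∈ b₁-i₃) ,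
      (b₁ , iY y₃ , d₁ , refl , b₁d₁ , d₁-i₃))

  ax5-map : ∀ y₁ y₂ y₃ x w → map (ζ y₁ y₃) x w → map (ζζ y₁ y₂ y₃) x w
  ax5-map y₁ y₂ y₃ x w m =
    let b , b∈ , xb = σ-successor y₁ y₂ (cInto y₁ x)
        k , γk = cOnto y₂ b b∈
        d , d∈ , bd = σ-successor y₂ y₃ b∈
        l , γl = cOnto y₃ d d∈
        b₁ , i₁b₁ , b₁-i₃ = S-transfer (ζ-map⇒σ y₁ y₃ m) xb refl
        d₁ , b₁d₁ , d₁-i₃ = S-transfer (sym b₁-i₃) bd refl
        y' , b₁∈ = iπsurj b₁
    in k , l ,
       σ⇒ζ-map y₁ y₂ {x} {k} (trans (cong (S (γs y₁ x)) γk) xb) ,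
       σ⇒ζ-map y₂ y₃ {k} {l} (trans (cong₂ S γk γl) bd) ,
       subst (λ z → ∃[ u ] (ζ-relates y₁ y₂ (Tʸ y₁ x* x*) u × ζ-relates y₂ y₃ u (S z (γs y₃ w)))) (sym γl)
         (ζζ-cod-witness y₁ y₂ y₃ b∈ (cInto y₃ w) d∈ b₁∈ i₁b₁ b₁-i₃ b₁d₁ d₁-i₃)

  action : IsAction T x* U y* Tʸ α ζ
  action = record
    { tauScheme = τ-scheme
    ; homC      = ζ-homC
    ; ax1-T     = ax1-T
    ; ax1-α     = ax1-α
    ; ax2       = ax2
    ; ax3       = ax3
    ; ax4       = ax4
    ; ax5       = λ y₁ y₂ y₃ → ax5-dom y₁ y₂ y₃ , ax5-cod y₁ y₂ y₃ , ax5-map y₁ y₂ y₃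
    }

theorem7p19 : ∀ {nX mT nY mU nZ mS}
    (T : Rel nX mT) (x* : Fin nX) (U : Rel nY mU) (y* : Fin nY)
    (S : Rel nZ mS) (z* : Fin nZ) (Tt : Sub mS)
    (γX : Fin nX → Fin nZ) (iY : Fin nY → Fin nZ) →
    Setting T x* U y* S z* Tt γX iY →
    (γs : Fin nY → Fin nX → Fin nZ) → Choice S Tt x* y* γX iY γs →
    IsAction T x* U y* (Ty S γs) (αC T S γX) (ζC T S Tt γX iY γs)
theorem7p19 T x* U y* S z* Tt γX iY setting γs choice =
  Construction.action T x* U y* S z* Tt γX iY setting γs choice
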